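{- Let $n\ge1$. There is a bijection $\varphi$ from the set $\mathcal{T}_n$ of plane trees with $n$ edges to the set $\mathcal{S}_n(321)$ of $321$-avoiding permutations of $\{1,\dots,n\}$ such that, for every $T\in\mathcal{T}_n$ with $\pi=\varphi(T)$: (1) the number of young leaves of $T$ equals the number of indices $i\in\{1,\dots,n-1\}$ such that both $\pi_i$ and $\pi_{i+1}$ are weak excedances of $\pi$; (2) the number of old leaves of $T$ equals the number of weak excedances $\pi_i$ of $\pi$ that are not immediately followed by another weak excedance (i.e. either $i=n$, or $\pi_{i+1}$ is not a weak excedance).
   Context: A plane tree is a rooted tree with the children of each vertex linearly ordered left to right; a leaf is a vertex with no children; a leaf is old if it is the leftmost child of its parent, young otherwise. A permutation $\pi=\pi_1\cdots\pi_n$ avoids $321$ if there are no indices $a<b<c$ with $\pi_a>\pi_b>\pi_c$. The entry $\pi_i$ is a weak excedance if $\pi_i\ge i$. -}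

module Defs where

open import Data.Nat using (ℕ; zero; suc; _+_; _≤_; _<_; _≤ᵇ_)
open import Data.Bool using (Bool; true; false; if_then_else_; _∧_; not)
open import Data.List using (List; []; _∷_; map)
open import Data.Fin using (Fin; toℕ)
open import Data.List using (allFin)
open import Data.Vec using (Vec; lookup)
open import Data.Product using (Σ; ∃; _×_)
open import Relation.Binary.PropositionalEquality using (_≡_)
open import Relation.Nullary using (¬_)

data Tree : Set where
  node : List Tree → Tree

mutual
  edges : Tree → ℕ
  edges (node ts) = edgesL ts

  edgesL : List Tree → ℕ
  edgesL []       = 0
  edgesL (t ∷ ts) = suc (edges t + edgesL ts)

isLeaf : Tree → Bool
isLeaf (node []) = true
isLeaf (node (_ ∷ _)) = false

b2n : Bool → ℕ
b2n true  = 1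
b2n false = 0

leafCount : List Tree → ℕ
leafCount []       = 0
leafCount (t ∷ ts) = b2n (isLeaf t) + leafCount ts

mutual
  -- old leaves: leaves that are the leftmost child of their parent
  oldLeaves : Tree → ℕ
  oldLeaves (node [])       = 0
  oldLeaves (node (t ∷ ts)) = b2n (isLeaf t) + oldLeavesL (t ∷ ts)

  oldLeavesL : List Tree → ℕ
  oldLeavesL []       = 0
  oldLeavesL (t ∷ ts) = oldLeaves t + oldLeavesL ts

mutual
  -- young leaves: leaves that are not the leftmost child of their parent
  youngLeaves : Tree → ℕ
  youngLeaves (node [])       = 0
  youngLeaves (node (t ∷ ts)) = leafCount ts + youngLeavesL (t ∷ ts)

  youngLeavesL : List Tree → ℕ
  youngLeavesL []       = 0
  youngLeavesL (t ∷ ts) = youngLeaves t + youngLeavesL ts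

PlaneTree : ℕ → Set
PlaneTree n = Σ Tree (λ t → edges t ≡ n)

-- Permutations of {1..n}, represented (0-indexed) as words
-- π = lookup π 0, ..., lookup π (n-1) over Fin n.

IsPerm : ∀ {n} → Vec (Fin n) n → Set
IsPerm {n} π = ∀ (i j : Fin n) → lookup π i ≡ lookup π j → i ≡ j

Avoids321 : ∀ {n} → Vec (Fin n) n → Set
Avoids321 {n} π =
  ¬ (Σ (Fin n) λ a → Σ (Fin n) λ b → Σ (Fin n) λ c →
       (toℕ a < toℕ b) × (toℕ b < toℕ c) ×
       (toℕ (lookup π b) < toℕ (lookup π a)) ×
       (toℕ (lookup π c) < toℕ (lookup π b)))

-- weak excedance at position i (1-indexed: π_i ≥ i; shifting both by one
-- gives the same condition for 0-indexed position and value)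
isWex : ∀ {n} → Vec (Fin n) n → Fin n → Bool
isWex π i = toℕ i ≤ᵇ toℕ (lookup π i)

wexWord : ∀ {n} → Vec (Fin n) n → List Bool
wexWord {n} π = map (isWex π) (allFin n)

adjTT : List Bool → ℕ
adjTT []           = 0
adjTT (b ∷ [])     = 0
adjTT (b ∷ c ∷ bs) = b2n (b ∧ c) + adjTT (c ∷ bs)

endT : List Bool → ℕ
endT []           = 0
endT (b ∷ [])     = b2n b
endT (b ∷ c ∷ bs) = b2n (b ∧ not c) + endT (c ∷ bs)

consecWex : ∀ {n} → Vec (Fin n) n → ℕ
consecWex π = adjTT (wexWord π)

lastWex : ∀ {n} → Vec (Fin n) n → ℕ
lastWex π = endT (wexWord π)

-- Code a plane tree by its Dyck path (children taken right to left), recording for each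
-- down-step the number of up-steps just before it.  The positive entries are the leaves, and a
-- positive entry is followed by another one exactly when its leaf has a left sibling, i.e. is
-- young.  Reading the code left to right, a positive entry places a new left-to-right maximum
-- and a zero entry places the least value skipped so far.  This gives a 321-avoiding
-- permutation whose weak excedances sit exactly at the positive entries, and every
-- 321-avoiding permutation arises exactly once, being determined by its left-to-right maxima
-- with the remaining values filled in increasingly.

module Submission where

open import Defs
open import Data.Bool using (Bool; true; false; _∧_; not)
open import Data.Bool.Properties using (∧-identityʳ; ∧-zeroʳ; T-≡; ¬-not)
open import Data.Empty using (⊥; ⊥-elim)
open import Data.Fin as Fin using (Fin; toℕ; fromℕ<)
open import Data.Fin.Properties
  using (toℕ<n; toℕ-fromℕ<; toℕ-injective; <⇒notInjective; punchOut-injective; any?)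
  renaming (_≟_ to _≟ᶠ_)
open import Data.List as List using (List; []; _∷_; _++_; length; map)
open import Data.List.Membership.Propositional using (_∈_)
open import Data.List.Membership.Propositional.Properties using (∈-++⁻; ∈-++⁺ˡ; ∈-++⁺ʳ)
open import Data.List.Properties
  using (++-assoc; ++-identityʳ; length-++; map-++; ∷-injectiveˡ; ∷-injectiveʳ; length-tabulate)
import Data.List.Properties as List
open import Data.List.Relation.Unary.All as All using (All; []; _∷_)
open import Data.List.Relation.Unary.All.Properties using (++⁺)
open import Data.List.Relation.Unary.AllPairs as AllPairs using (AllPairs; []; _∷_)
import Data.List.Relation.Unary.AllPairs.Properties as AllPairs
open import Data.List.Relation.Unary.Any using (here; there)
open import Data.List.Relation.Unary.Unique.Propositional using (Unique)
open import Data.Nat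
open import Data.Nat.Properties
open import Algebra.Properties.CommutativeSemigroup +-commutativeSemigroup
  using () renaming (interchange to +-interchange)
open import Data.Nat.Tactic.RingSolver using (solve-∀)
open import Data.Product using (Σ; ∃; ∃₂; _×_; _,_; proj₁; proj₂)
open import Data.Sum using (_⊎_; inj₁; inj₂)
open import Data.Unit using (⊤; tt)
open import Data.Vec as Vec using (Vec; lookup)
open import Data.Vec.Properties using (lookup∘tabulate; tabulate∘lookup)
import Data.Vec.Properties as Vec
open import Function.Base using (_∘_)
open import Function.Bundles using (Equivalence)
open import Relation.Binary using (tri<; tri≈; tri>)
open import Relation.Nullary using (yes; no)
open import Relation.Binary.PropositionalEquality

trueCount : List Bool → ℕ
trueCount []       = 0
trueCount (b ∷ bs) = b2n b + trueCount bs

trueCount-++ : ∀ xs ys → trueCount (xs ++ ys) ≡ trueCount xs + trueCount ys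
trueCount-++ []       ys = refl
trueCount-++ (x ∷ xs) ys =
  trans (cong (b2n x +_) (trueCount-++ xs ys)) (sym (+-assoc (b2n x) _ _))

endsTrue : List Bool → Bool
endsTrue []           = false
endsTrue (b ∷ [])     = b
endsTrue (_ ∷ b ∷ bs) = endsTrue (b ∷ bs)

endsTrue-++ : ∀ xs b ys → endsTrue (xs ++ b ∷ ys) ≡ endsTrue (b ∷ ys)
endsTrue-++ []            b ys = refl
endsTrue-++ (x ∷ [])      b ys = refl
endsTrue-++ (x ∷ x′ ∷ xs) b ys = endsTrue-++ (x′ ∷ xs) b ys

adjTT-++-true : ∀ xs ys →
  adjTT (xs ++ true ∷ ys) ≡ adjTT xs + b2n (endsTrue xs) + adjTT (true ∷ ys)
adjTT-++-true []            ys = refl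
adjTT-++-true (x ∷ [])      ys = cong (λ b → b2n b + adjTT (true ∷ ys)) (∧-identityʳ x)
adjTT-++-true (x ∷ x′ ∷ xs) ys =
  trans (cong (b2n (x ∧ x′) +_) (adjTT-++-true (x′ ∷ xs) ys))
        (reassoc (b2n (x ∧ x′)) (adjTT (x′ ∷ xs)) (b2n (endsTrue (x′ ∷ xs))) (adjTT (true ∷ ys)))
  where
  reassoc : ∀ p q r s → p + (q + r + s) ≡ p + q + r + s
  reassoc = solve-∀

adjTT-∷ʳ-false : ∀ xs → adjTT (xs ++ false ∷ []) ≡ adjTT xs
adjTT-∷ʳ-false []            = refl
adjTT-∷ʳ-false (x ∷ [])      = trans (+-identityʳ _) (cong b2n (∧-zeroʳ x))
adjTT-∷ʳ-false (x ∷ x′ ∷ xs) = cong (b2n (x ∧ x′) +_) (adjTT-∷ʳ-false (x′ ∷ xs))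

b2n-∧-split : ∀ a c → b2n (a ∧ c) + b2n (a ∧ not c) ≡ b2n a
b2n-∧-split true  true  = refl
b2n-∧-split true  false = refl
b2n-∧-split false c     = refl

adjTT+endT≡trueCount : ∀ bs → adjTT bs + endT bs ≡ trueCount bs
adjTT+endT≡trueCount []           = refl
adjTT+endT≡trueCount (b ∷ [])     = sym (+-identityʳ (b2n b))
adjTT+endT≡trueCount (b ∷ c ∷ bs) = begin
  b2n (b ∧ c) + adjTT (c ∷ bs) + (b2n (b ∧ not c) + endT (c ∷ bs))
    ≡⟨ +-interchange (b2n (b ∧ c)) (adjTT (c ∷ bs)) _ _ ⟩
  (b2n (b ∧ c) + b2n (b ∧ not c)) + (adjTT (c ∷ bs) + endT (c ∷ bs))
    ≡⟨ cong₂ _+_ (b2n-∧-split b c) (adjTT+endT≡trueCount (c ∷ bs)) ⟩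
  b2n b + trueCount (c ∷ bs) ∎
  where open ≡-Reasoning

-- Dyck codes of plane trees

bumpHead : List ℕ → List ℕ
bumpHead []      = []
bumpHead (d ∷ c) = suc d ∷ c

mutual
  encodeForest : List Tree → List ℕ
  encodeForest []       = []
  encodeForest (t ∷ ts) = encodeForest ts ++ encodeBranch t

  encodeBranch : Tree → List ℕ
  encodeBranch (node ts) = bumpHead (encodeForest ts ++ 0 ∷ [])

encode : Tree → List ℕ
encode (node ts) = encodeForest ts

mutual
  Dyck : ℕ → List ℕ → Set
  Dyck h []      = h ≡ 0
  Dyck h (d ∷ c) = Descent (h + d) c

  Descent : ℕ → List ℕ → Set
  Descent zero    c = ⊥
  Descent (suc h) c = Dyck h c

bumpHead-++ : ∀ x c → bumpHead (x ++ 0 ∷ []) ++ c ≡ bumpHead (x ++ 0 ∷ c)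
bumpHead-++ []      c = refl
bumpHead-++ (d ∷ x) c = cong (suc d ∷_) (++-assoc x (0 ∷ []) c)

encodeBranch-head : ∀ t → ∃₂ λ d r → encodeBranch t ≡ suc d ∷ r
encodeBranch-head (node ts) with encodeForest ts
... | []      = 0 , [] , refl
... | d ∷ x   = d , x ++ 0 ∷ [] , refl

encodeForest-head : ∀ t ts → ∃₂ λ d r → encodeForest (t ∷ ts) ≡ suc d ∷ r
encodeForest-head t []        = encodeBranch-head t
encodeForest-head t (t′ ∷ ts) with encodeForest-head t′ ts
... | d , r , eq = d , r ++ encodeBranch t , cong (_++ encodeBranch t) eq

mutual
  encodeForest-length : ∀ ts → length (encodeForest ts) ≡ edgesL ts
  encodeForest-length []       = refl
  encodeForest-length (t ∷ ts) = begin
    length (encodeForest ts ++ encodeBranch t)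
      ≡⟨ length-++ (encodeForest ts) ⟩
    length (encodeForest ts) + length (encodeBranch t)
      ≡⟨ cong₂ _+_ (encodeForest-length ts) (encodeBranch-length t) ⟩
    edgesL ts + suc (edges t)
      ≡⟨ +-comm (edgesL ts) _ ⟩
    suc (edges t + edgesL ts) ∎
    where open ≡-Reasoning

  encodeBranch-length : ∀ t → length (encodeBranch t) ≡ suc (edges t)
  encodeBranch-length (node ts) with encodeForest ts | encodeForest-length ts
  ... | []    | eq = cong suc eq
  ... | d ∷ x | eq = trans (length-++ (d ∷ x)) (trans (+-comm _ 1) (cong suc eq))

encode-length : ∀ t → length (encode t) ≡ edges t
encode-length (node ts) = encodeForest-length ts

-- Decoding is a stack machine whose frames collect the children of the open vertices: an
-- entry d opens d vertices and then closes the topmost one.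
Stack : Set
Stack = List (List Tree)

pushEmpty : ℕ → Stack → Stack
pushEmpty zero    s = s
pushEmpty (suc d) s = [] ∷ pushEmpty d s

closeTop : Stack → Stack
closeTop (cs ∷ ps ∷ st) = (node cs ∷ ps) ∷ st
closeTop s              = s

run : List ℕ → Stack → Stack
run []      s = s
run (d ∷ c) s = run c (closeTop (pushEmpty d s))

topFrame : Stack → List Tree
topFrame []      = []
topFrame (f ∷ _) = f

decode : List ℕ → Tree
decode c = node (topFrame (run c ([] ∷ [])))

pushEmpty-suc : ∀ d s → pushEmpty d ([] ∷ s) ≡ [] ∷ pushEmpty d s
pushEmpty-suc zero    s = refl
pushEmpty-suc (suc d) s = cong ([] ∷_) (pushEmpty-suc d s)

run-bumpHead : ∀ x e y s → run (bumpHead (x ++ e ∷ y)) s ≡ run (x ++ e ∷ y) ([] ∷ s)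
run-bumpHead []      e y s = cong (λ s′ → run y (closeTop s′)) (sym (pushEmpty-suc e s))
run-bumpHead (d ∷ x) e y s = cong (λ s′ → run (x ++ e ∷ y) (closeTop s′)) (sym (pushEmpty-suc d s))

mutual
  run-encodeForest : ∀ ts c ps st → run (encodeForest ts ++ c) (ps ∷ st) ≡ run c ((ts ++ ps) ∷ st)
  run-encodeForest []       c ps st = refl
  run-encodeForest (t ∷ ts) c ps st = begin
    run ((encodeForest ts ++ encodeBranch t) ++ c) (ps ∷ st)
      ≡⟨ cong (λ x → run x (ps ∷ st)) (++-assoc (encodeForest ts) (encodeBranch t) c) ⟩
    run (encodeForest ts ++ encodeBranch t ++ c) (ps ∷ st)
      ≡⟨ run-encodeForest ts (encodeBranch t ++ c) ps st ⟩
    run (encodeBranch t ++ c) ((ts ++ ps) ∷ st)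
      ≡⟨ run-encodeBranch t c (ts ++ ps) st ⟩
    run c ((t ∷ ts ++ ps) ∷ st) ∎
    where open ≡-Reasoning

  run-encodeBranch : ∀ t c ps st → run (encodeBranch t ++ c) (ps ∷ st) ≡ run c ((t ∷ ps) ∷ st)
  run-encodeBranch (node cs) c ps st = begin
    run (bumpHead (encodeForest cs ++ 0 ∷ []) ++ c) (ps ∷ st)
      ≡⟨ cong (λ x → run x (ps ∷ st)) (bumpHead-++ (encodeForest cs) c) ⟩
    run (bumpHead (encodeForest cs ++ 0 ∷ c)) (ps ∷ st)
      ≡⟨ run-bumpHead (encodeForest cs) 0 c (ps ∷ st) ⟩
    run (encodeForest cs ++ 0 ∷ c) ([] ∷ ps ∷ st)
      ≡⟨ run-encodeForest cs (0 ∷ c) [] (ps ∷ st) ⟩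
    run c ((node (cs ++ []) ∷ ps) ∷ st)
      ≡⟨ cong (λ cs′ → run c ((node cs′ ∷ ps) ∷ st)) (++-identityʳ cs) ⟩
    run c ((node cs ∷ ps) ∷ st) ∎
    where open ≡-Reasoning

decode-encode : ∀ t → decode (encode t) ≡ t
decode-encode (node cs) = cong (λ s → node (topFrame s)) (begin
  run (encodeForest cs) ([] ∷ [])      ≡⟨ cong (λ x → run x ([] ∷ [])) (sym (++-identityʳ (encodeForest cs))) ⟩
  run (encodeForest cs ++ []) ([] ∷ []) ≡⟨ run-encodeForest cs [] [] [] ⟩
  (cs ++ []) ∷ []                       ≡⟨ cong (_∷ []) (++-identityʳ cs) ⟩
  cs ∷ []                               ∎)
  where open ≡-Reasoning

-- flatten s y re-encodes the machine state s followed by the unread input y; running the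
-- machine preserves it.
flatten : Stack → List ℕ → List ℕ
flatten []          y = y
flatten (f ∷ [])    y = encodeForest f ++ y
flatten (f ∷ g ∷ s) y = flatten (g ∷ s) (bumpHead (encodeForest f ++ y))

flatten-pushEmpty : ∀ d g s e y →
  flatten (pushEmpty d (g ∷ s)) (e ∷ y) ≡ flatten (g ∷ s) (d + e ∷ y)
flatten-pushEmpty zero    g s e y = refl
flatten-pushEmpty (suc d) g s e y =
  trans (cong (λ s′ → flatten s′ (e ∷ y)) (sym (pushEmpty-suc d (g ∷ s))))
        (flatten-pushEmpty d [] (g ∷ s) e y)

encodeForest-close : ∀ ps cs y →
  encodeForest ps ++ bumpHead (encodeForest cs ++ 0 ∷ y) ≡ encodeForest (node cs ∷ ps) ++ y
encodeForest-close ps cs y =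
  trans (cong (encodeForest ps ++_) (sym (bumpHead-++ (encodeForest cs) y)))
        (sym (++-assoc (encodeForest ps) (encodeBranch (node cs)) y))

flatten-closeTop : ∀ cs ps st y → flatten (cs ∷ ps ∷ st) (0 ∷ y) ≡ flatten (closeTop (cs ∷ ps ∷ st)) y
flatten-closeTop cs ps []       y = encodeForest-close ps cs y
flatten-closeTop cs ps (g ∷ st) y = cong (λ x → flatten (g ∷ st) (bumpHead x)) (encodeForest-close ps cs y)

length-pushEmpty : ∀ d s {h} → length s ≡ suc h → length (pushEmpty d s) ≡ suc (h + d)
length-pushEmpty zero    s {h} len = trans len (cong suc (sym (+-identityʳ h)))
length-pushEmpty (suc d) s {h} len = cong suc (trans (length-pushEmpty d s len) (sym (+-suc h d)))

mutual
  run-Dyck : ∀ c h s → length s ≡ suc h → Dyck h c →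
             ∃ λ f → run c s ≡ f ∷ [] × flatten s c ≡ encodeForest f
  run-Dyck []      _ (f ∷ [])    _  _    = f , refl , ++-identityʳ (encodeForest f)
  run-Dyck []      _ (_ ∷ _ ∷ _) () refl
  run-Dyck (d ∷ c) h (g ∷ s) len v
    with run-Descent (h + d) (pushEmpty d (g ∷ s)) c (length-pushEmpty d (g ∷ s) len) v
  ... | f , ran , flat = f , ran , trans unpush flat
    where
    unpush : flatten (g ∷ s) (d ∷ c) ≡ flatten (pushEmpty d (g ∷ s)) (0 ∷ c)
    unpush = sym (trans (flatten-pushEmpty d g s 0 c) (cong (λ e → flatten (g ∷ s) (e ∷ c)) (+-identityʳ d)))

  run-Descent : ∀ k s c → length s ≡ suc k → Descent k c →
                ∃ λ f → run c (closeTop s) ≡ f ∷ [] × flatten s (0 ∷ c) ≡ encodeForest f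
  run-Descent (suc h) (cs ∷ ps ∷ st) c len v with run-Dyck c h ((node cs ∷ ps) ∷ st) (suc-injective len) v
  ... | f , ran , flat = f , ran , trans (flatten-closeTop cs ps st c) flat

encode-decode : ∀ c → Dyck 0 c → encode (decode c) ≡ c
encode-decode c v with run c ([] ∷ []) | run-Dyck c 0 ([] ∷ []) refl v
... | .(f ∷ []) | f , refl , flat = sym flat

Dyck-bumpHead : ∀ x e y h → Dyck (suc h) (x ++ e ∷ y) → Dyck h (bumpHead (x ++ e ∷ y))
Dyck-bumpHead []      e y h v = subst (λ k → Descent k y) (sym (+-suc h e)) v
Dyck-bumpHead (d ∷ x) e y h v = subst (λ k → Descent k (x ++ e ∷ y)) (sym (+-suc h d)) v

mutual
  Dyck-encodeForest : ∀ ts h c → Dyck h c → Dyck h (encodeForest ts ++ c)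
  Dyck-encodeForest []       h c v = v
  Dyck-encodeForest (t ∷ ts) h c v =
    subst (Dyck h) (sym (++-assoc (encodeForest ts) (encodeBranch t) c))
          (Dyck-encodeForest ts h (encodeBranch t ++ c) (Dyck-encodeBranch t h c v))

  Dyck-encodeBranch : ∀ t h c → Dyck h c → Dyck h (encodeBranch t ++ c)
  Dyck-encodeBranch (node cs) h c v =
    subst (Dyck h) (sym (bumpHead-++ (encodeForest cs) c))
      (Dyck-bumpHead (encodeForest cs) 0 c h
        (Dyck-encodeForest cs (suc h) (0 ∷ c) (subst (λ k → Dyck k c) (sym (+-identityʳ h)) v)))

Dyck-encode : ∀ t → Dyck 0 (encode t)
Dyck-encode (node cs) = subst (Dyck 0) (++-identityʳ (encodeForest cs)) (Dyck-encodeForest cs 0 [] refl)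

mutual
  Dyck-height≤length : ∀ h c → Dyck h c → h ≤ length c
  Dyck-height≤length h []      v = ≤-reflexive v
  Dyck-height≤length h (d ∷ c) v = ≤-trans (m≤m+n h d) (Descent-height≤length (h + d) c v)

  Descent-height≤length : ∀ k c → Descent k c → k ≤ suc (length c)
  Descent-height≤length (suc h) c v = s≤s (Dyck-height≤length h c v)

positive : ℕ → Bool
positive zero    = false
positive (suc _) = true

forestWord : List Tree → List Bool
forestWord ts = map positive (encodeForest ts)

branchWord : Tree → List Bool
branchWord t = map positive (encodeBranch t)

forestWord-cons : ∀ t ts → forestWord (t ∷ ts) ≡ forestWord ts ++ branchWord t
forestWord-cons t ts = map-++ positive (encodeForest ts) (encodeBranch t)

branchWord-head : ∀ t → ∃ λ r → branchWord t ≡ true ∷ r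
branchWord-head t with encodeBranch-head t
... | d , r , eq = map positive r , cong (map positive) eq

branchWord-node : ∀ c cs → branchWord (node (c ∷ cs)) ≡ forestWord (c ∷ cs) ++ false ∷ []
branchWord-node c cs with encodeForest-head c cs
... | d , r , eq rewrite eq = cong (true ∷_) (map-++ positive r (0 ∷ []))

endsTrue-branchWord : ∀ t → endsTrue (branchWord t) ≡ isLeaf t
endsTrue-branchWord (node [])       = refl
endsTrue-branchWord (node (c ∷ cs)) =
  trans (cong endsTrue (branchWord-node c cs)) (endsTrue-++ (forestWord (c ∷ cs)) false [])

endsTrue-forestWord : ∀ t ts → endsTrue (forestWord (t ∷ ts)) ≡ isLeaf t
endsTrue-forestWord t ts with branchWord-head t
... | r , eq = begin
  endsTrue (forestWord (t ∷ ts))        ≡⟨ cong endsTrue (trans (forestWord-cons t ts) (cong (forestWord ts ++_) eq)) ⟩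
  endsTrue (forestWord ts ++ true ∷ r)  ≡⟨ endsTrue-++ (forestWord ts) true r ⟩
  endsTrue (true ∷ r)                   ≡⟨ cong endsTrue (sym eq) ⟩
  endsTrue (branchWord t)               ≡⟨ endsTrue-branchWord t ⟩
  isLeaf t                              ∎
  where open ≡-Reasoning

youngLeaves-cons : ∀ t ts →
  youngLeaves (node ts) + b2n (endsTrue (forestWord ts)) + youngLeaves t ≡ youngLeaves (node (t ∷ ts))
youngLeaves-cons t []         = sym (+-identityʳ (youngLeaves t))
youngLeaves-cons t (t′ ∷ ts′) rewrite endsTrue-forestWord t′ ts′ =
  rearrange (leafCount ts′) (youngLeaves t′) (youngLeavesL ts′) (b2n (isLeaf t′)) (youngLeaves t)
  where
  rearrange : ∀ l y′ ys b y → l + (y′ + ys) + b + y ≡ b + l + (y + (y′ + ys))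
  rearrange = solve-∀

mutual
  adjTT-forestWord : ∀ ts → adjTT (forestWord ts) ≡ youngLeaves (node ts)
  adjTT-forestWord []       = refl
  adjTT-forestWord (t ∷ ts) with branchWord-head t
  ... | r , eq = begin
    adjTT (forestWord (t ∷ ts))
      ≡⟨ cong adjTT (trans (forestWord-cons t ts) (cong (forestWord ts ++_) eq)) ⟩
    adjTT (forestWord ts ++ true ∷ r)
      ≡⟨ adjTT-++-true (forestWord ts) r ⟩
    adjTT (forestWord ts) + b2n (endsTrue (forestWord ts)) + adjTT (true ∷ r)
      ≡⟨ cong₂ (λ y z → y + b2n (endsTrue (forestWord ts)) + z)
               (adjTT-forestWord ts) (trans (cong adjTT (sym eq)) (adjTT-branchWord t)) ⟩
    youngLeaves (node ts) + b2n (endsTrue (forestWord ts)) + youngLeaves t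
      ≡⟨ youngLeaves-cons t ts ⟩
    youngLeaves (node (t ∷ ts)) ∎
    where open ≡-Reasoning

  adjTT-branchWord : ∀ t → adjTT (branchWord t) ≡ youngLeaves t
  adjTT-branchWord (node [])       = refl
  adjTT-branchWord (node (c ∷ cs)) =
    trans (cong adjTT (branchWord-node c cs))
          (trans (adjTT-∷ʳ-false (forestWord (c ∷ cs))) (adjTT-forestWord (c ∷ cs)))

mutual
  nonRootLeaves : Tree → ℕ
  nonRootLeaves (node ts) = forestLeaves ts

  forestLeaves : List Tree → ℕ
  forestLeaves []       = 0
  forestLeaves (t ∷ ts) = b2n (isLeaf t) + nonRootLeaves t + forestLeaves ts

mutual
  trueCount-forestWord : ∀ ts → trueCount (forestWord ts) ≡ forestLeaves ts
  trueCount-forestWord []       = refl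
  trueCount-forestWord (t ∷ ts) = begin
    trueCount (forestWord (t ∷ ts))
      ≡⟨ cong trueCount (forestWord-cons t ts) ⟩
    trueCount (forestWord ts ++ branchWord t)
      ≡⟨ trueCount-++ (forestWord ts) (branchWord t) ⟩
    trueCount (forestWord ts) + trueCount (branchWord t)
      ≡⟨ cong₂ _+_ (trueCount-forestWord ts) (trueCount-branchWord t) ⟩
    forestLeaves ts + (b2n (isLeaf t) + nonRootLeaves t)
      ≡⟨ +-comm (forestLeaves ts) _ ⟩
    forestLeaves (t ∷ ts) ∎
    where open ≡-Reasoning

  trueCount-branchWord : ∀ t → trueCount (branchWord t) ≡ b2n (isLeaf t) + nonRootLeaves t
  trueCount-branchWord (node [])       = refl
  trueCount-branchWord (node (c ∷ cs)) =
    trans (cong trueCount (branchWord-node c cs))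
      (trans (trueCount-++ (forestWord (c ∷ cs)) (false ∷ []))
        (trans (+-identityʳ _) (trueCount-forestWord (c ∷ cs))))

mutual
  young+old≡nonRootLeaves : ∀ t → youngLeaves t + oldLeaves t ≡ nonRootLeaves t
  young+old≡nonRootLeaves (node [])       = refl
  young+old≡nonRootLeaves (node (c ∷ cs)) =
    trans (rearrange (leafCount cs) (youngLeavesL (c ∷ cs)) (b2n (isLeaf c)) (oldLeavesL (c ∷ cs)))
          (young+old+leafCount≡forestLeaves (c ∷ cs))
    where
    rearrange : ∀ l y b o → l + y + (b + o) ≡ y + o + (b + l)
    rearrange = solve-∀

  young+old+leafCount≡forestLeaves : ∀ ts → youngLeavesL ts + oldLeavesL ts + leafCount ts ≡ forestLeaves ts
  young+old+leafCount≡forestLeaves []       = refl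
  young+old+leafCount≡forestLeaves (t ∷ ts) =
    trans (rearrange (youngLeaves t) (youngLeavesL ts) (oldLeaves t) (oldLeavesL ts) (b2n (isLeaf t)) (leafCount ts))
          (cong₂ (λ x y → b2n (isLeaf t) + x + y) (young+old≡nonRootLeaves t) (young+old+leafCount≡forestLeaves ts))
    where
    rearrange : ∀ y ys o os b l → y + ys + (o + os) + (b + l) ≡ b + (y + o) + (ys + os + l)
    rearrange = solve-∀

youngLeaves≡adjTT : ∀ t → youngLeaves t ≡ adjTT (map positive (encode t))
youngLeaves≡adjTT (node cs) = sym (adjTT-forestWord cs)

-- Young and old leaves together are all the leaves, i.e. all positive entries, which are
-- also counted by adjTT + endT.
oldLeaves≡endT : ∀ t → oldLeaves t ≡ endT (map positive (encode t))
oldLeaves≡endT t@(node cs) = +-cancelˡ-≡ (youngLeaves t) _ _ (begin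
  youngLeaves t + oldLeaves t                      ≡⟨ young+old≡nonRootLeaves t ⟩
  forestLeaves cs                                  ≡⟨ sym (trueCount-forestWord cs) ⟩
  trueCount (forestWord cs)                        ≡⟨ sym (adjTT+endT≡trueCount (forestWord cs)) ⟩
  adjTT (forestWord cs) + endT (forestWord cs)     ≡⟨ cong (_+ endT (forestWord cs)) (adjTT-forestWord cs) ⟩
  youngLeaves t + endT (forestWord cs)             ∎)
  where open ≡-Reasoning

-- The 321-avoiding permutation of a Dyck code

range : ℕ → ℕ → List ℕ
range u zero    = []
range u (suc e) = u ∷ range (suc u) e

length-range : ∀ u e → length (range u e) ≡ e
length-range u zero    = refl
length-range u (suc e) = cong suc (length-range (suc u) e)

length-++-range : ∀ L u e → length (L ++ range u e) ≡ length L + e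
length-++-range L u e = trans (length-++ L) (cong (length L +_) (length-range u e))

range-≥ : ∀ u e → All (u ≤_) (range u e)
range-≥ u zero    = []
range-≥ u (suc e) = ≤-refl ∷ All.map (≤-trans (n≤1+n u)) (range-≥ (suc u) e)

range-< : ∀ u e → All (_< u + e) (range u e)
range-< u zero    = []
range-< u (suc e) =
  m<m+n u z<s ∷ subst (λ k → All (_< k) (range (suc u) e)) (sym (+-suc u e)) (range-< (suc u) e)

range-∈ : ∀ u e {y} → u ≤ y → y < u + e → y ∈ range u e
range-∈ u zero    {y} u≤y y<u+0 = ⊥-elim (<⇒≱ (subst (y <_) (+-identityʳ u) y<u+0) u≤y)
range-∈ u (suc e) {y} u≤y y<u+e with m≤n⇒m<n∨m≡n u≤y
... | inj₂ refl = here refl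
... | inj₁ u<y  = there (range-∈ (suc u) e u<y (subst (y <_) (+-suc u e) y<u+e))

range-sorted : ∀ u e → AllPairs _<_ (range u e)
range-sorted u zero    = []
range-sorted u (suc e) = range-≥ (suc u) e ∷ range-sorted (suc u) e

-- Reading the code from position i, with u the least value neither placed nor pooled and
-- L the increasing pool of skipped values: an ascent 1 + e places the new maximum u + e and
-- pools u, …, u + e − 1, while a plain descent places the least pooled value.  (The clause
-- with an empty pool is never reached on Dyck codes.)
toPerm : ℕ → List ℕ → List ℕ → List ℕ
toPerm u L       []          = []
toPerm u L       (suc e ∷ c) = u + e ∷ toPerm (suc (u + e)) (L ++ range u e) c
toPerm u []      (zero ∷ c)  = 0 ∷ toPerm u [] c
toPerm u (y ∷ L) (zero ∷ c)  = y ∷ toPerm u L c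

length-toPerm : ∀ u L c → length (toPerm u L c) ≡ length c
length-toPerm u L       []          = refl
length-toPerm u L       (suc e ∷ c) = cong suc (length-toPerm _ _ c)
length-toPerm u []      (zero ∷ c)  = cong suc (length-toPerm u [] c)
length-toPerm u (y ∷ L) (zero ∷ c)  = cong suc (length-toPerm u L c)

Dyck-afterAscent : ∀ L u e c → Dyck (length L) (suc e ∷ c) → Dyck (length (L ++ range u e)) c
Dyck-afterAscent L u e c v =
  subst (λ k → Dyck k c) (sym (length-++-range L u e))
        (subst (λ k → Descent k c) (+-suc (length L) e) v)

Dyck-beforeAscent : ∀ L u e c → Dyck (length (L ++ range u e)) c → Dyck (length L) (suc e ∷ c)
Dyck-beforeAscent L u e c v =
  subst (λ k → Descent k c) (sym (+-suc (length L) e))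
        (subst (λ k → Dyck k c) (length-++-range L u e) v)

Dyck-afterDescent : ∀ (y : ℕ) L c → Dyck (length (y ∷ L)) (0 ∷ c) → Dyck (length L) c
Dyck-afterDescent y L c = subst (λ k → Dyck k c) (+-identityʳ (length L))

Dyck-beforeDescent : ∀ (y : ℕ) L c → Dyck (length L) c → Dyck (length (y ∷ L)) (0 ∷ c)
Dyck-beforeDescent y L c = subst (λ k → Dyck k c) (sym (+-identityʳ (length L)))

All-toPerm : ∀ {P : ℕ → Set} u L c → Dyck (length L) c → All P L → (∀ {x} → u ≤ x → P x) →
             All P (toPerm u L c)
All-toPerm         u L       []          v PL        Pu = []
All-toPerm         u L       (suc e ∷ c) v PL        Pu =
  Pu (m≤m+n u e) ∷
  All-toPerm (suc (u + e)) (L ++ range u e) c (Dyck-afterAscent L u e c v)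
    (++⁺ PL (All.map Pu (range-≥ u e)))
    (λ u+e<x → Pu (≤-trans (m≤m+n u e) (<⇒≤ u+e<x)))
All-toPerm         u (y ∷ L) (zero ∷ c)  v (Py ∷ PL) Pu = Py ∷ All-toPerm u L c (Dyck-afterDescent y L c v) PL Pu

-- Placed from position i on, the k-th pooled value lies below position i + k, so pooled values
-- never become weak excedances.
BelowDiagonal : ℕ → List ℕ → Set
BelowDiagonal i []      = ⊤
BelowDiagonal i (y ∷ L) = y < i × BelowDiagonal (suc i) L

BelowDiagonal-weaken : ∀ {i j} → i ≤ j → ∀ L → BelowDiagonal i L → BelowDiagonal j L
BelowDiagonal-weaken i≤j []      _          = tt
BelowDiagonal-weaken i≤j (y ∷ L) (y<i , bd) = <-≤-trans y<i i≤j , BelowDiagonal-weaken (s≤s i≤j) L bd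

BelowDiagonal-++ : ∀ i L R → BelowDiagonal i L → BelowDiagonal (i + length L) R → BelowDiagonal i (L ++ R)
BelowDiagonal-++ i []      R _          bd = subst (λ k → BelowDiagonal k R) (+-identityʳ i) bd
BelowDiagonal-++ i (y ∷ L) R (y<i , bL) bd =
  y<i , BelowDiagonal-++ (suc i) L R bL (subst (λ k → BelowDiagonal k R) (+-suc i (length L)) bd)

BelowDiagonal-range : ∀ i u e → u < i → BelowDiagonal i (range u e)
BelowDiagonal-range i u zero    _   = tt
BelowDiagonal-range i u (suc e) u<i = u<i , BelowDiagonal-range (suc i) (suc u) e (s≤s u<i)

-- The pool after i positions: the values below u are exactly those placed or pooled.
record Pool (i u : ℕ) (L : List ℕ) : Set where
  field
    size     : i + length L ≡ u
    sorted   : AllPairs _<_ L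
    diagonal : BelowDiagonal i L
    bounded  : All (_< u) L
open Pool

pool-empty : Pool 0 0 []
pool-empty = record { size = refl ; sorted = [] ; diagonal = tt ; bounded = [] }

module _ {i u y L} (P : Pool i u (y ∷ L)) where
  least-below-position : y < i
  least-below-position = proj₁ (diagonal P)

  least-below-u : y < u
  least-below-u = All.head (bounded P)

  least-below-rest : All (y <_) L
  least-below-rest = AllPairs.head (sorted P)

  pool-descend : Pool (suc i) u L
  pool-descend = record
    { size     = trans (sym (+-suc i (length L))) (size P)
    ; sorted   = AllPairs.tail (sorted P)
    ; diagonal = proj₂ (diagonal P)
    ; bounded  = All.tail (bounded P) }

least-pooled : ∀ {i u L y} → Pool i u L → y ∈ L → ∃ λ y₀ → y₀ ∈ L × y₀ < i
least-pooled {L = y₀ ∷ _} P _ = y₀ , here refl , least-below-position P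

pooled⇒started : ∀ {i u L y} → Pool i u L → y ∈ L → i ≢ 0
pooled⇒started P y∈L refl with least-pooled P y∈L
... | _ , _ , ()

position≤u : ∀ {i u L} → Pool i u L → i ≤ u
position≤u {i} {L = L} P = ≤-trans (m≤m+n i (length L)) (≤-reflexive (size P))

pool-ascend : ∀ {i u L} e → Pool i u L → Pool (suc i) (suc (u + e)) (L ++ range u e)
pool-ascend {i} {u} {L} e P = record
  { size     = cong suc (begin
      i + length (L ++ range u e)   ≡⟨ cong (i +_) (length-++-range L u e) ⟩
      i + (length L + e)            ≡⟨ sym (+-assoc i (length L) e) ⟩
      i + length L + e              ≡⟨ cong (_+ e) (size P) ⟩
      u + e                         ∎)
  ; sorted   = AllPairs.++⁺ (sorted P) (range-sorted u e)
                 (All.map (λ y<u → All.map (<-≤-trans y<u) (range-≥ u e)) (bounded P))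
  ; diagonal = BelowDiagonal-++ (suc i) L (range u e)
                 (BelowDiagonal-weaken (n≤1+n i) L (diagonal P))
                 (BelowDiagonal-range (suc i + length L) u e (s≤s (≤-reflexive (sym (size P)))))
  ; bounded  = ++⁺ (All.map (λ y<u → <-≤-trans y<u (≤-trans (m≤m+n u e) (n≤1+n _))) (bounded P))
                   (All.map m<n⇒m<1+n (range-< u e)) }
  where open ≡-Reasoning

toPerm-below : ∀ {i u} L c → Pool i u L → Dyck (length L) c → All (_< i + length c) (toPerm u L c)
toPerm-below         L       []          P v = []
toPerm-below {i} {u} L       (suc e ∷ c) P v =
  <-≤-trans (s≤s u+e≤i+c) (≤-reflexive (sym (+-suc i (length c)))) ∷
  shift (toPerm-below (L ++ range u e) c (pool-ascend e P) v′)
  where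
  v′ = Dyck-afterAscent L u e c v
  shift = subst (λ k → All (_< k) (toPerm (suc (u + e)) (L ++ range u e) c)) (sym (+-suc i (length c)))
  u+e≤i+c : u + e ≤ i + length c
  u+e≤i+c = begin
    u + e              ≡⟨ cong (_+ e) (sym (size P)) ⟩
    i + length L + e   ≡⟨ +-assoc i (length L) e ⟩
    i + (length L + e) ≤⟨ +-monoʳ-≤ i (subst (_≤ length c) (length-++-range L u e) (Dyck-height≤length _ c v′)) ⟩
    i + length c       ∎
    where open ≤-Reasoning
toPerm-below {i} {u} (y ∷ L) (zero ∷ c)  P v =
  <-≤-trans (least-below-position P) (m≤m+n i _) ∷
  subst (λ k → All (_< k) (toPerm u L c)) (sym (+-suc i (length c)))
        (toPerm-below L c (pool-descend P) (Dyck-afterDescent y L c v))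

wexFrom : ℕ → List ℕ → List Bool
wexFrom i []       = []
wexFrom i (x ∷ xs) = (i ≤ᵇ x) ∷ wexFrom (suc i) xs

≤ᵇ-true : ∀ {m n} → m ≤ n → (m ≤ᵇ n) ≡ true
≤ᵇ-true m≤n = Equivalence.to T-≡ (≤⇒≤ᵇ m≤n)

≤ᵇ-false : ∀ {m n} → n < m → (m ≤ᵇ n) ≡ false
≤ᵇ-false {m} {n} n<m = ¬-not (λ m≤ᵇn → <⇒≱ n<m (≤ᵇ⇒≤ m n (Equivalence.from T-≡ m≤ᵇn)))

wexFrom-toPerm : ∀ {i u} L c → Pool i u L → Dyck (length L) c → wexFrom i (toPerm u L c) ≡ map positive c
wexFrom-toPerm         L       []          P v = refl
wexFrom-toPerm {i} {u} L       (suc e ∷ c) P v =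
  cong₂ _∷_ (≤ᵇ-true (≤-trans (position≤u P) (m≤m+n u e)))
            (wexFrom-toPerm (L ++ range u e) c (pool-ascend e P) (Dyck-afterAscent L u e c v))
wexFrom-toPerm         (y ∷ L) (zero ∷ c)  P v =
  cong₂ _∷_ (≤ᵇ-false (least-below-position P))
            (wexFrom-toPerm L c (pool-descend P) (Dyck-afterDescent y L c v))

toPerm-unique : ∀ {i u} L c → Pool i u L → Dyck (length L) c → Unique (toPerm u L c)
toPerm-unique         L       []          P v = []
toPerm-unique {u = u} L       (suc e ∷ c) P v =
  All-toPerm (suc (u + e)) (L ++ range u e) c v′
    (++⁺ (All.map (λ y<u → >⇒≢ (<-≤-trans y<u (m≤m+n u e))) (bounded P)) (All.map >⇒≢ (range-< u e)))
    <⇒≢ ∷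
  toPerm-unique (L ++ range u e) c (pool-ascend e P) v′
  where v′ = Dyck-afterAscent L u e c v
toPerm-unique {u = u} (y ∷ L) (zero ∷ c)  P v =
  All-toPerm u L c v′ (All.map <⇒≢ (least-below-rest P)) (λ u≤x → <⇒≢ (<-≤-trans (least-below-u P) u≤x)) ∷
  toPerm-unique L c (pool-descend P) v′
  where v′ = Dyck-afterDescent y L c v

-- Every entry either exceeds all earlier ones (which lie below m) or lies below all later ones;
-- this is the shape of a 321-avoiding permutation.
data MaxOrLeast : ℕ → List ℕ → Set where
  []     : ∀ {m} → MaxOrLeast m []
  max∷   : ∀ {m x xs} → m ≤ x → MaxOrLeast (suc x) xs → MaxOrLeast m (x ∷ xs)
  least∷ : ∀ {m x xs} → All (x <_) xs → MaxOrLeast m xs → MaxOrLeast m (x ∷ xs)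

toPerm-maxOrLeast : ∀ {i u} L c → Pool i u L → Dyck (length L) c → MaxOrLeast u (toPerm u L c)
toPerm-maxOrLeast         L       []          P v = []
toPerm-maxOrLeast {u = u} L       (suc e ∷ c) P v =
  max∷ (m≤m+n u e) (toPerm-maxOrLeast (L ++ range u e) c (pool-ascend e P) (Dyck-afterAscent L u e c v))
toPerm-maxOrLeast {u = u} (y ∷ L) (zero ∷ c)  P v =
  least∷ (All-toPerm u L c v′ (least-below-rest P) (<-≤-trans (least-below-u P)))
         (toPerm-maxOrLeast L c (pool-descend P) v′)
  where v′ = Dyck-afterDescent y L c v

toPerm-injective : ∀ {i u} L c c′ → Pool i u L → Dyck (length L) c → Dyck (length L) c′ →
                   toPerm u L c ≡ toPerm u L c′ → c ≡ c′
toPerm-injective L []          []           P v v′ eq = refl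
toPerm-injective L []          (suc _ ∷ _)  P v v′ ()
toPerm-injective L (suc _ ∷ _) []           P v v′ ()
toPerm-injective (_ ∷ _) []         (zero ∷ _) P v v′ ()
toPerm-injective (_ ∷ _) (zero ∷ _) []         P v v′ ()
toPerm-injective L (suc e ∷ c) (suc e′ ∷ c′) P v v′ eq with +-cancelˡ-≡ _ e e′ (∷-injectiveˡ eq)
... | refl = cong (suc e ∷_) (toPerm-injective (L ++ range _ e) c c′ (pool-ascend e P)
                 (Dyck-afterAscent L _ e c v) (Dyck-afterAscent L _ e c′ v′) (∷-injectiveʳ eq))
toPerm-injective (y ∷ L) (zero ∷ c) (zero ∷ c′) P v v′ eq =
  cong (0 ∷_) (toPerm-injective L c c′ (pool-descend P)
                 (Dyck-afterDescent y L c v) (Dyck-afterDescent y L c′ v′) (∷-injectiveʳ eq))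
toPerm-injective (y ∷ L) (zero ∷ c) (suc e ∷ c′) P v v′ eq =
  ⊥-elim (<⇒≢ (<-≤-trans (least-below-u P) (m≤m+n _ e)) (∷-injectiveˡ eq))
toPerm-injective (y ∷ L) (suc e ∷ c) (zero ∷ c′) P v v′ eq =
  ⊥-elim (<⇒≢ (<-≤-trans (least-below-u P) (m≤m+n _ e)) (sym (∷-injectiveˡ eq)))

nth : List ℕ → ℕ → ℕ
nth []       k       = 0
nth (x ∷ xs) zero    = x
nth (x ∷ xs) (suc k) = nth xs k

InjectiveOn : ℕ → (ℕ → ℕ) → Set
InjectiveOn n f = ∀ {a b} → a < n → b < n → f a ≡ f b → a ≡ b

Avoids321On : ℕ → (ℕ → ℕ) → Set
Avoids321On n f = ∀ {a b c} → a < b → b < c → c < n → f b < f a → f c < f b → ⊥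

All-nth : ∀ {P : ℕ → Set} xs {k} → All P xs → k < length xs → P (nth xs k)
All-nth (x ∷ xs) {zero}  (px ∷ _)   _         = px
All-nth (x ∷ xs) {suc k} (_  ∷ pxs) (s≤s k<n) = All-nth xs pxs k<n

Unique⇒nth-injective : ∀ {xs} → Unique xs → InjectiveOn (length xs) (nth xs)
Unique⇒nth-injective {x ∷ xs} _          {zero}  {zero}  _         _         _  = refl
Unique⇒nth-injective {x ∷ xs} (x∉ ∷ _)   {zero}  {suc b} _         (s≤s b<n) eq = ⊥-elim (All-nth xs x∉ b<n eq)
Unique⇒nth-injective {x ∷ xs} (x∉ ∷ _)   {suc a} {zero}  (s≤s a<n) _         eq = ⊥-elim (All-nth xs x∉ a<n (sym eq))
Unique⇒nth-injective {x ∷ xs} (_  ∷ xs!) {suc a} {suc b} (s≤s a<n) (s≤s b<n) eq =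
  cong suc (Unique⇒nth-injective xs! a<n b<n eq)

maxOrLeast-increasing : ∀ {m xs b c} → MaxOrLeast m xs → b < c → c < length xs →
                        nth xs b < m → nth xs b < nth xs c
maxOrLeast-increasing {xs = x ∷ xs} {zero}  {suc c} (max∷ m≤x _)  _         _         x<m = ⊥-elim (<⇒≱ x<m m≤x)
maxOrLeast-increasing {xs = x ∷ xs} {zero}  {suc c} (least∷ x< _) _         (s≤s c<n) _   = All-nth xs x< c<n
maxOrLeast-increasing {xs = x ∷ xs} {suc b} {suc c} (max∷ m≤x ml) (s≤s b<c) (s≤s c<n) lt  =
  maxOrLeast-increasing ml b<c c<n (<-≤-trans lt (≤-trans m≤x (n≤1+n x)))
maxOrLeast-increasing {xs = x ∷ xs} {suc b} {suc c} (least∷ _ ml) (s≤s b<c) (s≤s c<n) lt  =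
  maxOrLeast-increasing ml b<c c<n lt

maxOrLeast⇒avoids321 : ∀ {m xs} → MaxOrLeast m xs → Avoids321On (length xs) (nth xs)
maxOrLeast⇒avoids321 {xs = x ∷ xs} (max∷ _ ml)   {zero}  {suc b} {suc c} _         (s≤s b<c) (s≤s c<n) xb<x xc<xb =
  <⇒≱ (maxOrLeast-increasing ml b<c c<n (m<n⇒m<1+n xb<x)) (<⇒≤ xc<xb)
maxOrLeast⇒avoids321 {xs = x ∷ xs} (least∷ x< _) {zero}  {suc b} {suc c} _         (s≤s b<c) (s≤s c<n) xb<x _     =
  <⇒≱ xb<x (<⇒≤ (All-nth xs x< (<-trans b<c c<n)))
maxOrLeast⇒avoids321 {xs = x ∷ xs} (max∷ _ ml)   {suc a} {suc b} {suc c} (s≤s a<b) (s≤s b<c) (s≤s c<n) =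
  maxOrLeast⇒avoids321 ml a<b b<c c<n
maxOrLeast⇒avoids321 {xs = x ∷ xs} (least∷ _ ml) {suc a} {suc b} {suc c} (s≤s a<b) (s≤s b<c) (s≤s c<n) =
  maxOrLeast⇒avoids321 ml a<b b<c c<n

-- Inverting the construction

module Inverse (n : ℕ) (p : ℕ → ℕ)
  (p-injective : InjectiveOn n p)
  (p-below : ∀ {a} → a < n → p a < n)
  (p-onto : ∀ {y} → y < n → ∃ λ j → j < n × p j ≡ y)
  (p-avoids321 : Avoids321On n p) where

  -- The state after reading p 0, …, p (i − 1): u − 1 is their maximum and L lists, increasingly,
  -- the smaller values not among them.
  record Reading (i u : ℕ) (L : List ℕ) : Set where
    field
      pool           : Pool i u L
      pooled-unread  : ∀ {y} → y ∈ L → ∀ {k} → k < i → p k ≢ y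
      unread-pooled  : ∀ {y} → y < u → (∀ {k} → k < i → p k ≢ y) → y ∈ L
      maximum        : i ≡ 0 ⊎ ∃ λ a → a < i × suc (p a) ≡ u
      read-below     : ∀ {k} → k < i → p k < u
      u≤n            : u ≤ n
  open Reading

  reading-start : Reading 0 0 []
  reading-start = record
    { pool = pool-empty ; pooled-unread = λ () ; unread-pooled = λ () ; maximum = inj₁ refl
    ; read-below = λ () ; u≤n = z≤n }

  fresh : ∀ {i} → i < n → ∀ {k} → k < i → p k ≢ p i
  fresh i<n k<i pk≡pi = <⇒≢ k<i (p-injective (<-trans k<i i<n) i<n pk≡pi)

  module _ {i u L} (R : Reading i u L) (i<n : i < n) where

    pooled-read-later : ∀ {y} → y ∈ L → y < p i → ∃ λ j → i < j × j < n × p j ≡ y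
    pooled-read-later {y} y∈L y<pi with p-onto (<-≤-trans (All.lookup (bounded (pool R)) y∈L) (u≤n R))
    ... | j , j<n , pj≡y with <-cmp j i
    ... | tri< j<i _ _  = ⊥-elim (pooled-unread R y∈L j<i pj≡y)
    ... | tri≈ _ refl _ = ⊥-elim (<⇒≢ y<pi (sym pj≡y))
    ... | tri> _ _ i<j  = j , i<j , j<n , pj≡y

    -- The earlier maximum p a, p i and the later p j would form a 321.
    no-pooled-below : ∀ {y} → y ∈ L → y < p i → p i < u → ⊥
    no-pooled-below y∈L y<pi pi<u with maximum R | pooled-read-later y∈L y<pi
    ... | inj₁ i≡0 | _ = pooled⇒started (pool R) y∈L i≡0
    ... | inj₂ (a , a<i , pa+1≡u) | j , i<j , j<n , pj≡y =
      p-avoids321 a<i i<j j<n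
        (≤∧≢⇒< (s≤s⁻¹ (subst (p i <_) (sym pa+1≡u) pi<u)) (λ pi≡pa → fresh i<n a<i (sym pi≡pa)))
        (subst (_< p i) (sym pj≡y) y<pi)

    excedance-exceeds-pool : i ≤ p i → u ≤ p i
    excedance-exceeds-pool i≤pi with u ≤? p i
    ... | yes u≤pi = u≤pi
    ... | no  u≰pi with least-pooled (pool R) (unread-pooled R (≰⇒> u≰pi) (fresh i<n))
    ... | y₀ , y₀∈L , y₀<i = ⊥-elim (no-pooled-below y₀∈L (<-≤-trans y₀<i i≤pi) (≰⇒> u≰pi))

    deficiency-is-least-pooled : p i < i → ∃ λ L′ → L ≡ p i ∷ L′
    deficiency-is-least-pooled pi<i with unread-pooled R (<-≤-trans pi<i (position≤u (pool R))) (fresh i<n)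
    ... | here refl   = _ , refl
    ... | there pi∈L′ = ⊥-elim (no-pooled-below (here refl) (All.lookup (least-below-rest (pool R)) pi∈L′)
                                                (<-≤-trans pi<i (position≤u (pool R))))

    reading-ascend : ∀ e → u + e ≡ p i → Reading (suc i) (suc (u + e)) (L ++ range u e)
    reading-ascend e u+e≡pi = record
      { pool          = pool-ascend e (pool R)
      ; pooled-unread = pooled-unread′
      ; unread-pooled = unread-pooled′
      ; maximum       = inj₂ (i , n<1+n i , cong suc (sym u+e≡pi))
      ; read-below    = read-below′
      ; u≤n           = subst (_< n) (sym u+e≡pi) (p-below i<n) }
      where
      pooled-unread′ : ∀ {y} → y ∈ L ++ range u e → ∀ {k} → k < suc i → p k ≢ y
      pooled-unread′ y∈ k<1+i with ∈-++⁻ L y∈ | m≤n⇒m<n∨m≡n (s≤s⁻¹ k<1+i)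
      ... | inj₁ y∈L | inj₁ k<i = pooled-unread R y∈L k<i
      ... | inj₁ y∈L | inj₂ refl = λ pi≡y →
        <⇒≱ (subst (_< u) (sym pi≡y) (All.lookup (bounded (pool R)) y∈L)) (subst (u ≤_) u+e≡pi (m≤m+n u e))
      ... | inj₂ y∈r | inj₁ k<i = λ pk≡y →
        <⇒≱ (subst (_< u) pk≡y (read-below R k<i)) (All.lookup (range-≥ u e) y∈r)
      ... | inj₂ y∈r | inj₂ refl = λ pi≡y → <⇒≢ (All.lookup (range-< u e) y∈r) (sym (trans u+e≡pi pi≡y))
      unread-pooled′ : ∀ {y} → y < suc (u + e) → (∀ {k} → k < suc i → p k ≢ y) → y ∈ L ++ range u e
      unread-pooled′ {y} y<1+u+e unread with y <? u
      ... | yes y<u = ∈-++⁺ˡ (unread-pooled R y<u (λ k<i → unread (m<n⇒m<1+n k<i)))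
      ... | no  y≮u = ∈-++⁺ʳ L (range-∈ u e (≮⇒≥ y≮u)
                        (≤∧≢⇒< (s≤s⁻¹ y<1+u+e) (λ y≡u+e → unread (n<1+n i) (trans (sym u+e≡pi) (sym y≡u+e)))))
      read-below′ : ∀ {k} → k < suc i → p k < suc (u + e)
      read-below′ k<1+i with m≤n⇒m<n∨m≡n (s≤s⁻¹ k<1+i)
      ... | inj₁ k<i  = ≤-trans (read-below R k<i) (≤-trans (m≤m+n u e) (n≤1+n _))
      ... | inj₂ refl = s≤s (≤-reflexive (sym u+e≡pi))

  reading-descend : ∀ {i u L} → Reading i u (p i ∷ L) → Reading (suc i) u L
  reading-descend {i} {u} {L} R = record
    { pool          = pool-descend (pool R)
    ; pooled-unread = pooled-unread′
    ; unread-pooled = unread-pooled′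
    ; maximum       = maximum′ (maximum R)
    ; read-below    = read-below′
    ; u≤n           = u≤n R }
    where
    pooled-unread′ : ∀ {y} → y ∈ L → ∀ {k} → k < suc i → p k ≢ y
    pooled-unread′ y∈L k<1+i with m≤n⇒m<n∨m≡n (s≤s⁻¹ k<1+i)
    ... | inj₁ k<i  = pooled-unread R (there y∈L) k<i
    ... | inj₂ refl = <⇒≢ (All.lookup (least-below-rest (pool R)) y∈L)
    unread-pooled′ : ∀ {y} → y < u → (∀ {k} → k < suc i → p k ≢ y) → y ∈ L
    unread-pooled′ y<u unread with unread-pooled R y<u (λ k<i → unread (m<n⇒m<1+n k<i))
    ... | here y≡pi = ⊥-elim (unread (n<1+n i) (sym y≡pi))
    ... | there y∈L = y∈L
    maximum′ : i ≡ 0 ⊎ ∃ (λ a → a < i × suc (p a) ≡ u) →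
               suc i ≡ 0 ⊎ ∃ λ a → a < suc i × suc (p a) ≡ u
    maximum′ (inj₁ i≡0)                = ⊥-elim (pooled⇒started (pool R) (here refl) i≡0)
    maximum′ (inj₂ (a , a<i , pa+1≡u)) = inj₂ (a , m<n⇒m<1+n a<i , pa+1≡u)
    read-below′ : ∀ {k} → k < suc i → p k < u
    read-below′ k<1+i with m≤n⇒m<n∨m≡n (s≤s⁻¹ k<1+i)
    ... | inj₁ k<i  = read-below R k<i
    ... | inj₂ refl = least-below-u (pool R)

  reading-complete : ∀ {i u L} → Reading i u L → n ≤ i → L ≡ []
  reading-complete {L = []}    R n≤i = refl
  reading-complete {L = y ∷ L} R n≤i with p-onto (<-≤-trans (least-below-u (pool R)) (u≤n R))
  ... | j , j<n , pj≡y = ⊥-elim (pooled-unread R (here refl) (<-≤-trans j<n n≤i) pj≡y)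

  unfinished : ∀ {i k} → i + suc k ≡ n → i < n
  unfinished {i} i+k+1≡n = subst (i <_) i+k+1≡n (m<m+n i z<s)

  build : ∀ k {i u L} → i + k ≡ n → Reading i u L →
          ∃ λ c → Dyck (length L) c × toPerm u L c ≡ map p (range i k)
  build zero    {i} i+0≡n R with reading-complete R (subst (_≤ i) i+0≡n (≤-reflexive (+-identityʳ i)))
  ... | refl = [] , refl , refl
  build (suc k) {i} {u} {L} i+k+1≡n R with i ≤? p i
  ... | yes i≤pi with m≤n⇒∃[o]m+o≡n (excedance-exceeds-pool R (unfinished i+k+1≡n) i≤pi)
  ... | e , u+e≡pi with build k (trans (sym (+-suc i k)) i+k+1≡n) (reading-ascend R (unfinished i+k+1≡n) e u+e≡pi)
  ... | c , v , g = suc e ∷ c , Dyck-beforeAscent L u e c v , cong₂ _∷_ u+e≡pi g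
  build (suc k) {i} {u} {L} i+k+1≡n R | no i≰pi with deficiency-is-least-pooled R (unfinished i+k+1≡n) (≰⇒> i≰pi)
  ... | L′ , refl with build k (trans (sym (+-suc i k)) i+k+1≡n) (reading-descend R)
  ... | c , v , g = 0 ∷ c , Dyck-beforeDescent (p i) L′ c v , cong (p i ∷_) g

nth-tabulate : ∀ {n} (f : Fin n → ℕ) j → nth (List.tabulate f) (toℕ j) ≡ f j
nth-tabulate f Fin.zero    = refl
nth-tabulate f (Fin.suc j) = nth-tabulate (f ∘ Fin.suc) j

tabulate-nth : ∀ xs {n} → length xs ≡ n → List.tabulate {n = n} (nth xs ∘ toℕ) ≡ xs
tabulate-nth []       {zero}  _   = refl
tabulate-nth (x ∷ xs) {suc n} len = cong (x ∷_) (tabulate-nth xs (suc-injective len))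

map-nth-shift : ∀ x xs u k → map (nth (x ∷ xs)) (range (suc u) k) ≡ map (nth xs) (range u k)
map-nth-shift x xs u zero    = refl
map-nth-shift x xs u (suc k) = cong (nth xs u ∷_) (map-nth-shift x xs (suc u) k)

map-nth-range : ∀ xs {n} → length xs ≡ n → map (nth xs) (range 0 n) ≡ xs
map-nth-range []       {zero}  _   = refl
map-nth-range (x ∷ xs) {suc n} len = cong (x ∷_) (trans (map-nth-shift x xs 0 n) (map-nth-range xs (suc-injective len)))

values : ∀ {n} → Vec (Fin n) n → List ℕ
values π = List.tabulate (toℕ ∘ lookup π)

length-values : ∀ {n} (π : Vec (Fin n) n) → length (values π) ≡ n
length-values π = length-tabulate (toℕ ∘ lookup π)

values-injective : ∀ {n} {π π′ : Vec (Fin n) n} → values π ≡ values π′ → π ≡ π′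
values-injective {π = π} {π′} eq = begin
  π                        ≡⟨ tabulate∘lookup π ⟨
  Vec.tabulate (lookup π)  ≡⟨ Vec.tabulate-cong (λ j → toℕ-injective (lookup-agrees j)) ⟩
  Vec.tabulate (lookup π′) ≡⟨ tabulate∘lookup π′ ⟩
  π′                       ∎
  where
  open ≡-Reasoning
  lookup-agrees : ∀ j → toℕ (lookup π j) ≡ toℕ (lookup π′ j)
  lookup-agrees j = trans (sym (nth-tabulate (toℕ ∘ lookup π) j))
                          (trans (cong (λ xs → nth xs (toℕ j)) eq) (nth-tabulate (toℕ ∘ lookup π′) j))

fromValues : ∀ {n} xs → length xs ≡ n → All (_< n) xs → Vec (Fin n) n
fromValues xs len below = Vec.tabulate λ j → fromℕ< (All-nth xs below (subst (toℕ j <_) (sym len) (toℕ<n j)))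

values-fromValues : ∀ {n} xs (len : length xs ≡ n) (below : All (_< n) xs) → values (fromValues xs len below) ≡ xs
values-fromValues xs len below = begin
  List.tabulate (toℕ ∘ lookup (fromValues xs len below)) ≡⟨ List.tabulate-cong (λ j →
    trans (cong toℕ (lookup∘tabulate _ j)) (toℕ-fromℕ< _)) ⟩
  List.tabulate (nth xs ∘ toℕ)                            ≡⟨ tabulate-nth xs len ⟩
  xs                                                      ∎
  where open ≡-Reasoning

wexFrom-tabulate : ∀ {n} i (f : Fin n → ℕ) →
                   wexFrom i (List.tabulate f) ≡ List.tabulate (λ j → i + toℕ j ≤ᵇ f j)
wexFrom-tabulate {zero}  i f = refl
wexFrom-tabulate {suc n} i f = cong₂ _∷_ (cong (_≤ᵇ f Fin.zero) (sym (+-identityʳ i)))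
  (trans (wexFrom-tabulate (suc i) (f ∘ Fin.suc))
         (List.tabulate-cong (λ j → cong (_≤ᵇ f (Fin.suc j)) (sym (+-suc i (toℕ j))))))

-- A missed value y would make j ↦ punchOut y (f j) an injection Fin (1 + m) → Fin m.
injective⇒surjective : ∀ {n} (f : Fin n → Fin n) → (∀ i j → f i ≡ f j → i ≡ j) →
                       ∀ y → ∃ λ j → f j ≡ y
injective⇒surjective {suc m} f f-inj y with any? (λ j → f j ≟ᶠ y)
... | yes hit  = hit
... | no  miss = ⊥-elim (<⇒notInjective {f = λ j → Fin.punchOut (avoids j)} (n<1+n m)
                           (λ eq → f-inj _ _ (punchOut-injective (avoids _) (avoids _) eq)))
  where
  avoids : ∀ j → y ≢ f j
  avoids j y≡fj = miss (j , sym y≡fj)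

module _ {n} (π : Vec (Fin n) n) where

  nth-values-toℕ : ∀ j → nth (values π) (toℕ j) ≡ toℕ (lookup π j)
  nth-values-toℕ = nth-tabulate (toℕ ∘ lookup π)

  nth-values : ∀ {k} (k<n : k < n) → nth (values π) k ≡ toℕ (lookup π (fromℕ< k<n))
  nth-values k<n = trans (cong (nth (values π)) (sym (toℕ-fromℕ< k<n))) (nth-values-toℕ (fromℕ< k<n))

  wexWord≡wexFrom-values : wexWord π ≡ wexFrom 0 (values π)
  wexWord≡wexFrom-values =
    trans (List.map-tabulate (λ j → j) (isWex π)) (sym (wexFrom-tabulate 0 (toℕ ∘ lookup π)))

  injectiveOn⇒isPerm : InjectiveOn n (nth (values π)) → IsPerm π
  injectiveOn⇒isPerm inj i j πi≡πj = toℕ-injective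
    (inj (toℕ<n i) (toℕ<n j) (trans (nth-values-toℕ i) (trans (cong toℕ πi≡πj) (sym (nth-values-toℕ j)))))

  isPerm⇒injectiveOn : IsPerm π → InjectiveOn n (nth (values π))
  isPerm⇒injectiveOn perm a<n b<n πa≡πb =
    trans (sym (toℕ-fromℕ< a<n))
      (trans (cong toℕ (perm _ _ (toℕ-injective (trans (sym (nth-values a<n)) (trans πa≡πb (nth-values b<n))))))
             (toℕ-fromℕ< b<n))

  avoids321On⇒avoids321 : Avoids321On n (nth (values π)) → Avoids321 π
  avoids321On⇒avoids321 avoids (a , b , c , a<b , b<c , πb<πa , πc<πb) =
    avoids a<b b<c (toℕ<n c)
      (subst₂ _<_ (sym (nth-values-toℕ b)) (sym (nth-values-toℕ a)) πb<πa)
      (subst₂ _<_ (sym (nth-values-toℕ c)) (sym (nth-values-toℕ b)) πc<πb)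

  values-below : ∀ {a} → a < n → nth (values π) a < n
  values-below a<n = subst (_< n) (sym (nth-values a<n)) (toℕ<n _)

  isPerm⇒values-onto : IsPerm π → ∀ {y} → y < n → ∃ λ j → j < n × nth (values π) j ≡ y
  isPerm⇒values-onto perm y<n with injective⇒surjective (lookup π) perm (fromℕ< y<n)
  ... | j , πj≡y = toℕ j , toℕ<n j , trans (nth-values-toℕ j) (trans (cong toℕ πj≡y) (toℕ-fromℕ< y<n))

  avoids321⇒avoids321On : Avoids321 π → Avoids321On n (nth (values π))
  avoids321⇒avoids321On avoids {a} {b} {c} a<b b<c c<n πb<πa πc<πb = avoids
    ( fromℕ< a<n , fromℕ< b<n , fromℕ< c<n
    , subst₂ _<_ (sym (toℕ-fromℕ< a<n)) (sym (toℕ-fromℕ< b<n)) a<b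
    , subst₂ _<_ (sym (toℕ-fromℕ< b<n)) (sym (toℕ-fromℕ< c<n)) b<c
    , subst₂ _<_ (nth-values b<n) (nth-values a<n) πb<πa
    , subst₂ _<_ (nth-values c<n) (nth-values b<n) πc<πb )
    where
    b<n = <-trans b<c c<n
    a<n = <-trans a<b b<n

encode-injective : ∀ {t t′} → encode t ≡ encode t′ → t ≡ t′
encode-injective {t} {t′} eq = trans (sym (decode-encode t)) (trans (cong decode eq) (decode-encode t′))

treeValues : Tree → List ℕ
treeValues t = toPerm 0 [] (encode t)

length-treeValues : ∀ t → length (treeValues t) ≡ edges t
length-treeValues t = trans (length-toPerm 0 [] (encode t)) (encode-length t)

treeValues-below : ∀ t → All (_< edges t) (treeValues t)
treeValues-below t = subst (λ m → All (_< m) (treeValues t)) (encode-length t)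
                           (toPerm-below [] (encode t) pool-empty (Dyck-encode t))

treeValues-injectiveOn : ∀ t → InjectiveOn (edges t) (nth (treeValues t))
treeValues-injectiveOn t = subst (λ m → InjectiveOn m (nth (treeValues t))) (length-treeValues t)
  (Unique⇒nth-injective (toPerm-unique [] (encode t) pool-empty (Dyck-encode t)))

treeValues-avoids321On : ∀ t → Avoids321On (edges t) (nth (treeValues t))
treeValues-avoids321On t = subst (λ m → Avoids321On m (nth (treeValues t))) (length-treeValues t)
  (maxOrLeast⇒avoids321 (toPerm-maxOrLeast [] (encode t) pool-empty (Dyck-encode t)))

treePerm : ∀ {n} → PlaneTree n → Vec (Fin n) n
treePerm (t , refl) = fromValues (treeValues t) (length-treeValues t) (treeValues-below t)

values-treePerm : ∀ {n} (T : PlaneTree n) → values (treePerm T) ≡ treeValues (proj₁ T)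
values-treePerm (t , refl) = values-fromValues (treeValues t) (length-treeValues t) (treeValues-below t)

treePerm-isPerm : ∀ {n} (T : PlaneTree n) → IsPerm (treePerm T)
treePerm-isPerm T@(t , refl) = injectiveOn⇒isPerm (treePerm T)
  (subst (λ xs → InjectiveOn (edges t) (nth xs)) (sym (values-treePerm T)) (treeValues-injectiveOn t))

treePerm-avoids321 : ∀ {n} (T : PlaneTree n) → Avoids321 (treePerm T)
treePerm-avoids321 T@(t , refl) = avoids321On⇒avoids321 (treePerm T)
  (subst (λ xs → Avoids321On (edges t) (nth xs)) (sym (values-treePerm T)) (treeValues-avoids321On t))

treePerm-injective : ∀ {n} (T T′ : PlaneTree n) → treePerm T ≡ treePerm T′ → proj₁ T ≡ proj₁ T′
treePerm-injective (t , e) (t′ , e′) eq = encode-injective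
  (toPerm-injective [] (encode t) (encode t′) pool-empty (Dyck-encode t) (Dyck-encode t′)
    (trans (sym (values-treePerm (t , e))) (trans (cong values eq) (values-treePerm (t′ , e′)))))

treePerm-surjective : ∀ {n} (π : Vec (Fin n) n) → IsPerm π → Avoids321 π → ∃ λ T → treePerm T ≡ π
treePerm-surjective {n} π perm avoids with build n refl reading-start
  where
  open Inverse n (nth (values π)) (isPerm⇒injectiveOn π perm) (values-below π) (isPerm⇒values-onto π perm)
                 (avoids321⇒avoids321On π avoids)
... | c , v , g =
  tree , values-injective (trans (values-treePerm tree) (trans (cong (toPerm 0 []) (encode-decode c v)) g′))
  where
  g′ : toPerm 0 [] c ≡ values π
  g′ = trans g (map-nth-range (values π) (length-values π))
  edges-decode : edges (decode c) ≡ n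
  edges-decode = begin
    edges (decode c)           ≡⟨ encode-length (decode c) ⟨
    length (encode (decode c)) ≡⟨ cong length (encode-decode c v) ⟩
    length c                   ≡⟨ length-toPerm 0 [] c ⟨
    length (toPerm 0 [] c)     ≡⟨ cong length g′ ⟩
    length (values π)          ≡⟨ length-values π ⟩
    n                          ∎
    where open ≡-Reasoning
  tree : PlaneTree n
  tree = decode c , edges-decode

wexWord-treePerm : ∀ {n} (T : PlaneTree n) → wexWord (treePerm T) ≡ map positive (encode (proj₁ T))
wexWord-treePerm T@(t , _) = begin
  wexWord (treePerm T)            ≡⟨ wexWord≡wexFrom-values (treePerm T) ⟩
  wexFrom 0 (values (treePerm T)) ≡⟨ cong (wexFrom 0) (values-treePerm T) ⟩
  wexFrom 0 (treeValues t)        ≡⟨ wexFrom-toPerm [] (encode t) pool-empty (Dyck-encode t) ⟩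
  map positive (encode t)         ∎
  where open ≡-Reasoning

mainTheorem5 : (n : ℕ) → 1 ≤ n →
    Σ (PlaneTree n → Vec (Fin n) n) λ φ →
      (∀ T → IsPerm (φ T) × Avoids321 (φ T)) ×
      (∀ T T′ → φ T ≡ φ T′ → proj₁ T ≡ proj₁ T′) ×
      (∀ π → IsPerm π → Avoids321 π → Σ (PlaneTree n) λ T → φ T ≡ π) ×
      (∀ T → (youngLeaves (proj₁ T) ≡ consecWex (φ T)) ×
             (oldLeaves (proj₁ T) ≡ lastWex (φ T)))
mainTheorem5 n _ =
  treePerm ,
  (λ T → treePerm-isPerm T , treePerm-avoids321 T) ,
  treePerm-injective ,
  treePerm-surjective ,
  λ T → trans (youngLeaves≡adjTT (proj₁ T)) (cong adjTT (sym (wexWord-treePerm T))) ,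
        trans (oldLeaves≡endT (proj₁ T)) (cong endT (sym (wexWord-treePerm T)))
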